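{- For all integers $n,m\geq 2$, $R(P_n,K_{1,m})=t(n,m)$.
   Context: All graphs are finite and simple. $P_n$ denotes the path on $n$ vertices and $K_{1,m}$ the star on $m+1$ vertices. For graphs $G_1,G_2$, the Ramsey number $R(G_1,G_2)$ is the least integer $r$ such that for every graph $G$ on $r$ vertices, either $G$ contains a subgraph isomorphic to $G_1$ or the complement $\overline{G}$ contains a subgraph isomorphic to $G_2$. For integers $n,m\geq 2$, let $\alpha=\frac{m-1}{n-1}$, $\beta=\lceil\alpha\rceil$ and $\gamma=\frac{\beta^2}{\beta+1}$, and define $$t(n,m)=\begin{cases}(n-1)\beta+1, & \alpha\leq\gamma;\\ \lfloor (m-1)/\beta\rfloor+m, & \alpha>\gamma.\end{cases}$$ -}

module Defs where

open import Data.Nat using (ℕ; zero; suc; _+_; _*_; _∸_; _≤ᵇ_; _<_) renaming (_≟_ to _ℕ≟_)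
open import Data.Nat.Properties using (1+n≢n)
open import Data.Bool.Properties using (∨-comm)
open import Data.Empty using (⊥-elim)
open import Data.Sum using (_⊎_)
open import Data.Nat.DivMod using (_/_)
open import Data.Bool using (Bool; true; false; not; _∧_; _∨_; if_then_else_)
open import Data.Fin using (Fin; zero; suc; toℕ; _≟_)
open import Data.Product using (Σ; _×_; _,_)
open import Function.Definitions using (Injective)
open import Relation.Binary.PropositionalEquality using (_≡_; refl; cong; cong₂)
open import Relation.Nullary using (¬_; yes; no)
open import Relation.Nullary.Decidable using (⌊_⌋)

record Graph (r : ℕ) : Set where
  field
    adj    : Fin r → Fin r → Bool
    sym    : ∀ i j → adj i j ≡ adj j i
    irrefl : ∀ i → adj i i ≡ false
open Graph public

neq : ∀ {r} → Fin r → Fin r → Bool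
neq i j = not ⌊ i ≟ j ⌋

neq-sym : ∀ {r} (i j : Fin r) → neq i j ≡ neq j i
neq-sym i j with i ≟ j | j ≟ i
... | yes _ | yes _ = refl
... | no _  | no _  = refl
... | yes refl | no q = ⊥-elim (q refl)
... | no p  | yes refl = ⊥-elim (p refl)

neq-irrefl : ∀ {r} (i : Fin r) → neq i i ≡ false
neq-irrefl i with i ≟ i
... | yes _ = refl
... | no p = ⊥-elim (p refl)

complement : ∀ {r} → Graph r → Graph r
complement G = record
  { adj    = λ i j → not (adj G i j) ∧ neq i j
  ; sym    = λ i j → cong₂ (λ a b → not a ∧ b) (sym G i j) (neq-sym i j)
  ; irrefl = λ i → cong₂ (λ a b → not a ∧ b) (irrefl G i) (neq-irrefl i)
  }

_⊆G_ : ∀ {k r} → Graph k → Graph r → Set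
_⊆G_ {k} {r} H G =
  Σ (Fin k → Fin r) λ f → Injective _≡_ _≡_ f ×
    (∀ i j → adj H i j ≡ true → adj G (f i) (f j) ≡ true)

pathAdj : ∀ {n} → Fin n → Fin n → Bool
pathAdj i j = ⌊ suc (toℕ i) ℕ≟ toℕ j ⌋ ∨ ⌊ suc (toℕ j) ℕ≟ toℕ i ⌋

pathAdj-sym : ∀ {n} (i j : Fin n) → pathAdj i j ≡ pathAdj j i
pathAdj-sym i j = ∨-comm ⌊ suc (toℕ i) ℕ≟ toℕ j ⌋ ⌊ suc (toℕ j) ℕ≟ toℕ i ⌋

pathAdj-irrefl : ∀ {n} (i : Fin n) → pathAdj i i ≡ false
pathAdj-irrefl i with suc (toℕ i) ℕ≟ toℕ i
... | yes p = ⊥-elim (1+n≢n p)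
... | no _ = refl

P : (n : ℕ) → Graph n
P n = record { adj = pathAdj ; sym = pathAdj-sym ; irrefl = pathAdj-irrefl }

starAdj : ∀ {m} → Fin (suc m) → Fin (suc m) → Bool
starAdj zero    zero    = false
starAdj zero    (suc _) = true
starAdj (suc _) zero    = true
starAdj (suc _) (suc _) = false

starAdj-sym : ∀ {m} (i j : Fin (suc m)) → starAdj i j ≡ starAdj j i
starAdj-sym zero zero = refl
starAdj-sym zero (suc _) = refl
starAdj-sym (suc _) zero = refl
starAdj-sym (suc _) (suc _) = refl

starAdj-irrefl : ∀ {m} (i : Fin (suc m)) → starAdj i i ≡ false
starAdj-irrefl zero = refl
starAdj-irrefl (suc _) = refl

K1 : (m : ℕ) → Graph (suc m)
K1 m = record { adj = starAdj ; sym = starAdj-sym ; irrefl = starAdj-irrefl }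

Arrows : ∀ {a b} → ℕ → Graph a → Graph b → Set
Arrows r G1 G2 = (G : Graph r) → G1 ⊆G G ⊎ G2 ⊆G complement G

IsRamsey : ∀ {a b} → Graph a → Graph b → ℕ → Set
IsRamsey G1 G2 t = Arrows t G1 G2 × (∀ r → r < t → ¬ Arrows r G1 G2)

-- β = ⌈(m-1)/(n-1)⌉, given d = n-1 (0 if d = 0, irrelevant case).
ceilDiv : ℕ → ℕ → ℕ
ceilDiv a zero    = 0
ceilDiv a (suc d) = (a + d) / suc d

floorDiv : ℕ → ℕ → ℕ
floorDiv a zero    = 0
floorDiv a (suc b) = a / suc b

-- t(n,m). With α = (m-1)/(n-1), γ = β²/(β+1), the condition α ≤ γ is
-- equivalent (n ≥ 2) to (m-1)(β+1) ≤ β²(n-1), cleared of denominators.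
t : ℕ → ℕ → ℕ
t n m =
  let a = m ∸ 1 ; d = n ∸ 1 ; β = ceilDiv a d in
  if (a * (β + 1)) ≤ᵇ (β * β * d)
    then d * β + 1
    else floorDiv a β + m

-- Upper bound: if the complement of G (on r vertices) has no K_{1,m}, every vertex of G has degree
-- at least δ = r − m.  When n ≤ 2δ + 1, every vertex lies on a P_n or in a set of fewer than n
-- vertices closed under adjacency: grow a path through it, extending it at an end while possible;
-- otherwise each end has ≥ δ neighbours on a path of ≤ 2δ vertices, so (Pósa) the path closes into
-- a cycle, which is reopened at any vertex with a neighbour off it.  Peeling off these closed sets
-- splits the r vertices into k parts of sizes between δ + 1 and n − 1, and in both cases of t(n,m)
-- no k satisfies k(δ + 1) ≤ r ≤ k(n − 1).
-- Lower bound: t(n,m) − 1 vertices carry a disjoint union of cliques, each of fewer than n vertices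
-- and with fewer than m vertices outside it: β cliques of size n − 1 if α ≤ γ, and otherwise β + 1
-- cliques of sizes q = ⌊(m − 1)/β⌋ and q + 1.

module Submission where

open import Defs hiding (sym)

open import Data.Bool using (Bool; true; false; not; _∧_; _∨_; if_then_else_; T)
open import Data.Bool.Properties
  using (∧-conicalˡ; ∧-conicalʳ; ∧-identityʳ; ∧-zeroʳ; ¬-not; not-¬) renaming (_≟_ to _≟ᵇ_)
open import Data.Empty using (⊥; ⊥-elim)
open import Data.Fin
  using (Fin; zero; suc; toℕ; _≟_; inject≤; inject₁; splitAt; join; punchIn; punchOut; _↑ˡ_; _↑ʳ_)
open import Data.Fin.Properties
  using (any?; suc-injective; toℕ-inject₁; toℕ-inject≤; inject≤-injective; splitAt-↑ˡ; splitAt-↑ʳ;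
         join-splitAt; punchIn-injective; punchInᵢ≢i; punchOut-injective; punchIn-punchOut)
open import Data.List using (List; []; _∷_; _++_; _∷ʳ_; length; map; lookup; replicate)
open import Data.List.Properties using (map-id)
open import Data.List.Membership.Propositional using (_∈_; _∉_)
open import Data.List.Membership.Propositional.Properties using (∈-lookup; ∈-∃++)
open import Data.List.Relation.Binary.Permutation.Propositional
  using (_↭_; ↭-refl; ↭-sym; ↭-trans; ↭-prep; ↭⇒↭ₛ)
open import Data.List.Relation.Binary.Permutation.Propositional.Properties
  using (∈-resp-↭; ++-comm; ∷↭∷ʳ; ++⁺ˡ; ↭-length)
import Data.List.Relation.Binary.Permutation.Setoid.Properties as ↭ₛ
open import Data.List.Relation.Unary.All as All using (All)
open import Data.List.Relation.Unary.All.Properties using (¬Any⇒All¬; replicate⁺; ++⁺)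
import Data.List.Relation.Unary.AllPairs.Core as AllPairs
open import Data.List.Relation.Unary.Any as Any using (Any; here; there)
open import Data.List.Relation.Unary.Unique.Propositional using (Unique)
open import Data.Nat
  using (ℕ; zero; suc; _+_; _*_; _∸_; _%_; _≤_; _<_; _≤?_; _≤ᵇ_; z≤n; s≤s; >-nonZero)
open import Data.Nat.DivMod using (m≡m%n+[m/n]*n; m%n<n; m/n*n≤m; m≥n⇒m/n>0)
open import Data.Nat.ListAction using (sum)
open import Data.Nat.ListAction.Properties using (sum-++)
open import Data.Nat.Properties hiding (_≟_; suc-injective)
open import Algebra.Properties.CommutativeSemigroup +-commutativeSemigroup
  using () renaming (interchange to +-interchange)
import Data.Nat.Properties as ℕ
open import Data.Nat.Tactic.RingSolver using (solve)
open import Data.Product using (Σ; Σ-syntax; ∃-syntax; _×_; _,_; proj₁; proj₂)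
open import Data.Sum using (_⊎_; inj₁; inj₂; [_,_]′)
open import Data.Unit using (tt)
open import Function using (id; const; _∘_; case_of_)
open import Function.Definitions using (Injective)
open import Relation.Binary.PropositionalEquality
open import Relation.Binary.PropositionalEquality.Properties using (setoid)
open import Relation.Nullary using (¬_; Dec; yes; no; _×-dec_; ¬?)
open import Relation.Nullary.Decidable using (⌊_⌋)

neq⇒≢ : ∀ {r} (x u : Fin r) → neq x u ≡ true → x ≢ u
neq⇒≢ x .x neq≡true refl = case trans (sym neq≡true) (neq-irrefl x) of λ ()

neq-suc : ∀ {r} (x u : Fin r) → neq (suc x) (suc u) ≡ neq x u
neq-suc x u with x ≟ u
... | yes _ = refl
... | no  _ = refl

neq-injective : ∀ {a b} {f : Fin a → Fin b} → Injective _≡_ _≡_ f →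
  ∀ i j → neq i j ≡ true → neq (f i) (f j) ≡ true
neq-injective {f = f} f-inj i j i≠j with f i ≟ f j
... | yes fi≡fj = ⊥-elim (neq⇒≢ i j i≠j (f-inj fi≡fj))
... | no  _     = refl

⌊≟⌋-sym : ∀ a b → ⌊ a ℕ.≟ b ⌋ ≡ ⌊ b ℕ.≟ a ⌋
⌊≟⌋-sym a b with a ℕ.≟ b | b ℕ.≟ a
... | yes _    | yes _   = refl
... | no  _    | no  _   = refl
... | yes refl | no b≢a  = ⊥-elim (b≢a refl)
... | no  a≢b  | yes refl = ⊥-elim (a≢b refl)

⌊≟⌋-suc : ∀ a b → ⌊ suc a ℕ.≟ suc b ⌋ ≡ ⌊ a ℕ.≟ b ⌋
⌊≟⌋-suc a b with a ℕ.≟ b | suc a ℕ.≟ suc b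
... | yes _   | yes _       = refl
... | no  _   | no  _       = refl
... | yes refl | no 1+a≢1+b = ⊥-elim (1+a≢1+b refl)
... | no  a≢b | yes 1+a≡1+b = ⊥-elim (a≢b (ℕ.suc-injective 1+a≡1+b))

⌊≟⌋⇒≡ : ∀ {a b} → ⌊ a ℕ.≟ b ⌋ ≡ true → a ≡ b
⌊≟⌋⇒≡ {a} {b} a≟b with a ℕ.≟ b
... | yes a≡b = a≡b
... | no  _   = case a≟b of λ ()

≡⇒⌊≟⌋ : ∀ {a b} → a ≡ b → ⌊ a ℕ.≟ b ⌋ ≡ true
≡⇒⌊≟⌋ {a} {b} a≡b with a ℕ.≟ b
... | yes _   = refl
... | no  a≢b = ⊥-elim (a≢b a≡b)

-- Counting

𝟙 : Bool → ℕ
𝟙 true  = 1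
𝟙 false = 0

𝟙≤1 : ∀ b → 𝟙 b ≤ 1
𝟙≤1 true  = ≤-refl
𝟙≤1 false = z≤n

𝟙-mono : ∀ a b → (a ≡ true → b ≡ true) → 𝟙 a ≤ 𝟙 b
𝟙-mono true  b a⇒b rewrite a⇒b refl = ≤-refl
𝟙-mono false b _   = z≤n

count : ∀ {r} → (Fin r → Bool) → ℕ
count {zero}  S = 0
count {suc r} S = 𝟙 (S zero) + count (S ∘ suc)

countᴸ : {A : Set} → (A → Bool) → List A → ℕ
countᴸ S []       = 0
countᴸ S (x ∷ xs) = 𝟙 (S x) + countᴸ S xs

count-cong : ∀ {r} {S T : Fin r → Bool} → (∀ i → S i ≡ T i) → count S ≡ count T
count-cong {zero}  S≗T = refl
count-cong {suc r} S≗T = cong₂ _+_ (cong 𝟙 (S≗T zero)) (count-cong (S≗T ∘ suc))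

count-mono : ∀ {r} (S T : Fin r → Bool) → (∀ i → S i ≡ true → T i ≡ true) → count S ≤ count T
count-mono {zero}  S T S⊆T = z≤n
count-mono {suc r} S T S⊆T =
  +-mono-≤ (𝟙-mono _ _ (S⊆T zero)) (count-mono (S ∘ suc) (T ∘ suc) (S⊆T ∘ suc))

count-< : ∀ {r} (S T : Fin r → Bool) → (∀ i → S i ≡ true → T i ≡ true) →
  ∀ x → S x ≡ false → T x ≡ true → count S < count T
count-< {suc r} S T S⊆T zero Sx Tx rewrite Sx | Tx = s≤s (count-mono (S ∘ suc) (T ∘ suc) (S⊆T ∘ suc))
count-< {suc r} S T S⊆T (suc x) Sx Tx = begin-strict
  𝟙 (S zero) + count (S ∘ suc)
    <⟨ +-monoʳ-< (𝟙 (S zero)) (count-< (S ∘ suc) (T ∘ suc) (S⊆T ∘ suc) x Sx Tx) ⟩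
  𝟙 (S zero) + count (T ∘ suc)
    ≤⟨ +-monoˡ-≤ _ (𝟙-mono _ _ (S⊆T zero)) ⟩
  𝟙 (T zero) + count (T ∘ suc) ∎
  where open ≤-Reasoning

count-const-false : ∀ {r} (S : Fin r → Bool) → (∀ i → S i ≡ false) → count S ≡ 0
count-const-false {zero}  S S≡false = refl
count-const-false {suc r} S S≡false rewrite S≡false zero = count-const-false (S ∘ suc) (S≡false ∘ suc)

count-const-true : ∀ {r} (S : Fin r → Bool) → (∀ i → S i ≡ true) → count S ≡ r
count-const-true {zero}  S S≡true = refl
count-const-true {suc r} S S≡true rewrite S≡true zero =
  cong suc (count-const-true (S ∘ suc) (S≡true ∘ suc))

𝟙-split : ∀ a b → 𝟙 a ≡ 𝟙 (a ∧ b) + 𝟙 (a ∧ not b)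
𝟙-split true  true  = refl
𝟙-split true  false = refl
𝟙-split false b     = refl

count-split : ∀ {r} (S T : Fin r → Bool) →
  count S ≡ count (λ i → S i ∧ T i) + count (λ i → S i ∧ not (T i))
count-split {zero}  S T = refl
count-split {suc r} S T =
  trans (cong₂ _+_ (𝟙-split (S zero) (T zero)) (count-split (S ∘ suc) (T ∘ suc)))
        (+-interchange (𝟙 (S zero ∧ T zero)) _ _ _)

count-complement : ∀ {r} (S : Fin r → Bool) → count S + count (not ∘ S) ≡ r
count-complement S =
  trans (sym (count-split (λ _ → true) S)) (count-const-true (λ _ → true) (λ _ → refl))

count-remove : ∀ {r} (S : Fin r → Bool) x → count S ≤ count (λ u → S u ∧ neq x u) + 𝟙 (S x)
count-remove {suc r} S zero rewrite ∧-zeroʳ (S zero) = begin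
  𝟙 (S zero) + count (S ∘ suc)                  ≡⟨ +-comm (𝟙 (S zero)) _ ⟩
  count (S ∘ suc) + 𝟙 (S zero)                  ≡⟨ cong (_+ 𝟙 (S zero)) (count-cong λ u → sym (∧-identityʳ (S (suc u)))) ⟩
  count (λ u → S (suc u) ∧ true) + 𝟙 (S zero)   ∎
  where open ≤-Reasoning
count-remove {suc r} S (suc x) rewrite ∧-identityʳ (S zero) = begin
  𝟙 (S zero) + count (S ∘ suc)                                        ≤⟨ +-monoʳ-≤ _ (count-remove (S ∘ suc) x) ⟩
  𝟙 (S zero) + (count (λ u → S (suc u) ∧ neq x u) + 𝟙 (S (suc x)))    ≡⟨ +-assoc (𝟙 (S zero)) _ _ ⟨
  𝟙 (S zero) + count (λ u → S (suc u) ∧ neq x u) + 𝟙 (S (suc x))      ≡⟨ cong (λ c → 𝟙 (S zero) + c + 𝟙 (S (suc x))) shift ⟩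
  𝟙 (S zero) + count (λ u → S (suc u) ∧ neq (suc x) (suc u)) + 𝟙 (S (suc x)) ∎
  where
  open ≤-Reasoning
  shift : count (λ u → S (suc u) ∧ neq x u) ≡ count (λ u → S (suc u) ∧ neq (suc x) (suc u))
  shift = count-cong λ u → cong (S (suc u) ∧_) (sym (neq-suc x u))

count-↑ : ∀ a {b} (S : Fin (a + b) → Bool) → count S ≡ count (S ∘ (_↑ˡ b)) + count (S ∘ (a ↑ʳ_))
count-↑ zero    S = refl
count-↑ (suc a) S = trans (cong (𝟙 (S zero) +_) (count-↑ a (S ∘ suc))) (sym (+-assoc (𝟙 (S zero)) _ _))

countᴸ-mono : {A : Set} (S T : A → Bool) (xs : List A) → (∀ x → S x ≡ true → T x ≡ true) →
  countᴸ S xs ≤ countᴸ T xs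
countᴸ-mono S T []       S⊆T = z≤n
countᴸ-mono S T (x ∷ xs) S⊆T = +-mono-≤ (𝟙-mono _ _ (S⊆T x)) (countᴸ-mono S T xs S⊆T)

countᴸ≤length : {A : Set} (S : A → Bool) (xs : List A) → countᴸ S xs ≤ length xs
countᴸ≤length S []       = z≤n
countᴸ≤length S (x ∷ xs) = +-mono-≤ (𝟙≤1 (S x)) (countᴸ≤length S xs)

countᴸ-disjoint : {A : Set} (S T : A → Bool) (xs : List A) → All (λ x → S x ∧ T x ≡ false) xs →
  countᴸ S xs + countᴸ T xs ≤ length xs
countᴸ-disjoint S T []       All.[]         = z≤n
countᴸ-disjoint S T (x ∷ xs) (Sx∧Tx≡false All.∷ disj) = begin
  𝟙 (S x) + countᴸ S xs + (𝟙 (T x) + countᴸ T xs)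
    ≡⟨ +-interchange (𝟙 (S x)) _ _ _ ⟩
  𝟙 (S x) + 𝟙 (T x) + (countᴸ S xs + countᴸ T xs)
    ≤⟨ +-mono-≤ (disjoint (S x) (T x) Sx∧Tx≡false) (countᴸ-disjoint S T xs disj) ⟩
  suc (length xs) ∎
  where
  open ≤-Reasoning
  disjoint : ∀ a b → a ∧ b ≡ false → 𝟙 a + 𝟙 b ≤ 1
  disjoint true  false _ = ≤-refl
  disjoint false b     _ = 𝟙≤1 b

count≤countᴸ : {A : Set} {r : ℕ} (S : Fin r → Bool) (g : A → Fin r) (xs : List A) →
  (∀ u → S u ≡ true → u ∈ map g xs) → count S ≤ countᴸ (S ∘ g) xs
count≤countᴸ S g [] covered = ≤-reflexive (count-const-false S outside)
  where
  outside : ∀ u → S u ≡ false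
  outside u with S u in Su
  ... | false = refl
  ... | true  with covered u Su
  ...   | ()
count≤countᴸ {r = r} S g (x ∷ xs) covered = begin
  count S
    ≤⟨ count-remove S (g x) ⟩
  count S′ + 𝟙 (S (g x))
    ≤⟨ +-monoˡ-≤ _ (count≤countᴸ S′ g xs covered′) ⟩
  countᴸ (S′ ∘ g) xs + 𝟙 (S (g x))
    ≤⟨ +-monoˡ-≤ _ (countᴸ-mono (S′ ∘ g) (S ∘ g) xs (λ y → ∧-conicalˡ _ _)) ⟩
  countᴸ (S ∘ g) xs + 𝟙 (S (g x))
    ≡⟨ +-comm _ (𝟙 (S (g x))) ⟩
  𝟙 (S (g x)) + countᴸ (S ∘ g) xs ∎
  where
  open ≤-Reasoning
  S′ : Fin r → Bool
  S′ u = S u ∧ neq (g x) u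
  covered′ : ∀ u → S′ u ≡ true → u ∈ map g xs
  covered′ u S′u with covered u (∧-conicalˡ _ _ S′u)
  ... | here u≡gx  = ⊥-elim (neq⇒≢ (g x) u (∧-conicalʳ _ _ S′u) (sym u≡gx))
  ... | there u∈xs = u∈xs

InjectsInto : ℕ → ∀ {r} → (Fin r → Bool) → Set
InjectsInto k {r} S = Σ (Fin k → Fin r) λ f → Injective _≡_ _≡_ f × (∀ i → S (f i) ≡ true)

≤count⇒InjectsInto : ∀ {r} (S : Fin r → Bool) k → k ≤ count S → InjectsInto k S
≤count⇒InjectsInto S zero _ = (λ ()) , (λ {i} → case i of λ ()) , λ ()
≤count⇒InjectsInto {suc r} S (suc k) 1+k≤count with S zero in S0
... | false with ≤count⇒InjectsInto (S ∘ suc) (suc k) 1+k≤count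
...   | f , f-inj , f∈S = suc ∘ f , f-inj ∘ suc-injective , f∈S
≤count⇒InjectsInto {suc r} S (suc k) (s≤s k≤count) | true with ≤count⇒InjectsInto (S ∘ suc) k k≤count
...   | f , f-inj , f∈S = f′ , f′-inj , f′∈S
  where
  f′ : Fin (suc k) → Fin (suc r)
  f′ zero    = zero
  f′ (suc i) = suc (f i)
  f′-inj : Injective _≡_ _≡_ f′
  f′-inj {zero}  {zero}  _  = refl
  f′-inj {suc i} {suc j} eq = cong suc (f-inj (suc-injective eq))
  f′∈S : ∀ i → S (f′ i) ≡ true
  f′∈S zero    = S0
  f′∈S (suc i) = f∈S i

-- Pigeonhole: drop the vertex zero, together with its preimage under f if it has one.
InjectsInto⇒≤count : ∀ {r} (S : Fin r → Bool) k → InjectsInto k S → k ≤ count S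
InjectsInto⇒≤count S zero _ = z≤n
InjectsInto⇒≤count {zero} S (suc k) (f , _) = case f zero of λ ()
InjectsInto⇒≤count {suc r} S (suc k) (f , f-inj , f∈S) with any? (λ i → f i ≟ zero)
... | no f≢0 = ≤-trans (InjectsInto⇒≤count (S ∘ suc) (suc k) (g , g-inj , g∈S)) (m≤n+m _ _)
  where
  0≢f : ∀ i → zero ≢ f i
  0≢f i = f≢0 ∘ (i ,_) ∘ sym
  g : Fin (suc k) → Fin r
  g i = punchOut (0≢f i)
  g-inj : Injective _≡_ _≡_ g
  g-inj {i} {j} eq = f-inj (punchOut-injective (0≢f i) (0≢f j) eq)
  g∈S : ∀ i → S (suc (g i)) ≡ true
  g∈S i = subst (λ u → S u ≡ true) (sym (punchIn-punchOut (0≢f i))) (f∈S i)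
... | yes (i , fi≡0) = begin
  suc k                  ≤⟨ s≤s (InjectsInto⇒≤count (S ∘ suc) k (g , g-inj , g∈S)) ⟩
  suc (count (S ∘ suc))  ≡⟨ cong (λ b → 𝟙 b + count (S ∘ suc)) S0 ⟨
  count S                ∎
  where
  open ≤-Reasoning
  S0 : S zero ≡ true
  S0 = subst (λ u → S u ≡ true) fi≡0 (f∈S i)
  0≢f : ∀ j → zero ≢ f (punchIn i j)
  0≢f j 0≡f = punchInᵢ≢i i j (f-inj (trans (sym 0≡f) (sym fi≡0)))
  g : Fin k → Fin r
  g j = punchOut (0≢f j)
  g-inj : Injective _≡_ _≡_ g
  g-inj {j} {j′} eq = punchIn-injective i j j′ (f-inj (punchOut-injective (0≢f j) (0≢f j′) eq))
  g∈S : ∀ j → S (suc (g j)) ≡ true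
  g∈S j = subst (λ u → S u ≡ true) (sym (punchIn-punchOut (0≢f j))) (f∈S (punchIn i j))

Unique⇒lookup-injective : {A : Set} {xs : List A} → Unique xs → Injective _≡_ _≡_ (lookup xs)
Unique⇒lookup-injective {xs = _ ∷ _} _                      {zero}  {zero}  _  = refl
Unique⇒lookup-injective {xs = _ ∷ _} (x∉xs AllPairs.∷ _)   {zero}  {suc j} eq =
  ⊥-elim (All.lookup x∉xs (∈-lookup j) eq)
Unique⇒lookup-injective {xs = _ ∷ _} (x∉xs AllPairs.∷ _)   {suc i} {zero}  eq =
  ⊥-elim (All.lookup x∉xs (∈-lookup i) (sym eq))
Unique⇒lookup-injective {xs = _ ∷ _} (_ AllPairs.∷ unique) {suc i} {suc j} eq =
  cong suc (Unique⇒lookup-injective unique eq)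

Unique-resp-↭ : {A : Set} {xs ys : List A} → xs ↭ ys → Unique xs → Unique ys
Unique-resp-↭ {A} xs↭ys = ↭ₛ.Unique-resp-↭ (setoid A) (↭⇒↭ₛ xs↭ys)

sum-bounds : ∀ {a b} cs → All (λ c → a ≤ c × c ≤ b) cs →
  length cs * a ≤ sum cs × sum cs ≤ length cs * b
sum-bounds []       All.[]                   = z≤n , z≤n
sum-bounds (c ∷ cs) ((a≤c , c≤b) All.∷ bnds) with sum-bounds cs bnds
... | lower , upper = +-mono-≤ a≤c lower , +-mono-≤ c≤b upper

sum-replicate : ∀ k x → sum (replicate k x) ≡ k * x
sum-replicate zero    x = refl
sum-replicate (suc k) x = cong (x +_) (sum-replicate k x)

replicate⁺-nonempty : ∀ {P : ℕ → Set} k {x} → (0 < k → P x) → All P (replicate k x)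
replicate⁺-nonempty zero    _   = All.[]
replicate⁺-nonempty (suc k) Px = Px (s≤s z≤n) All.∷ replicate⁺ k (Px (s≤s z≤n))

⊆G-trans : ∀ {a b c} {H : Graph a} {G : Graph b} {K : Graph c} → H ⊆G G → G ⊆G K → H ⊆G K
⊆G-trans (f , f-inj , f-edge) (g , g-inj , g-edge) =
  g ∘ f , f-inj ∘ g-inj , λ i j → g-edge (f i) (f j) ∘ f-edge i j

induced : ∀ {r s} → r ≤ s → Graph s → Graph r
induced r≤s G = record
  { adj    = λ i j → adj G (inject≤ i r≤s) (inject≤ j r≤s)
  ; sym    = λ i j → Graph.sym G (inject≤ i r≤s) (inject≤ j r≤s)
  ; irrefl = λ i → Graph.irrefl G (inject≤ i r≤s)
  }

induced⊆G : ∀ {r s} (r≤s : r ≤ s) (G : Graph s) → induced r≤s G ⊆G G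
induced⊆G r≤s G = (λ i → inject≤ i r≤s) , inject≤-injective r≤s r≤s _ _ , λ i j ij → ij

complement-induced⊆G : ∀ {r s} (r≤s : r ≤ s) (G : Graph s) → complement (induced r≤s G) ⊆G complement G
complement-induced⊆G r≤s G = (λ i → inject≤ i r≤s) , ι-inj , edge
  where
  ι-inj : Injective _≡_ _≡_ (λ i → inject≤ i r≤s)
  ι-inj = inject≤-injective r≤s r≤s _ _
  edge : ∀ i j → adj (complement (induced r≤s G)) i j ≡ true →
    adj (complement G) (inject≤ i r≤s) (inject≤ j r≤s) ≡ true
  edge i j ij rewrite ∧-conicalˡ (not (adj G (inject≤ i r≤s) (inject≤ j r≤s))) _ ij =
    neq-injective ι-inj i j (∧-conicalʳ _ _ ij)

Arrows-mono : ∀ {a b r s} {G₁ : Graph a} {G₂ : Graph b} → r ≤ s → Arrows r G₁ G₂ → Arrows s G₁ G₂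
Arrows-mono {G₁ = G₁} {G₂} r≤s arrows G with arrows (induced r≤s G)
... | inj₁ G₁⊆ = inj₁ (⊆G-trans {H = G₁} {G = induced r≤s G} {K = G} G₁⊆ (induced⊆G r≤s G))
... | inj₂ G₂⊆ = inj₂ (⊆G-trans {H = G₂} {G = complement (induced r≤s G)} {K = complement G}
                                G₂⊆ (complement-induced⊆G r≤s G))

IsRamsey-suc : ∀ {a b s} {G₁ : Graph a} {G₂ : Graph b} →
  Arrows (suc s) G₁ G₂ → ¬ Arrows s G₁ G₂ → IsRamsey G₁ G₂ (suc s)
IsRamsey-suc {G₁ = G₁} {G₂} arrows ¬arrows =
  arrows , λ r r<1+s → ¬arrows ∘ Arrows-mono {G₁ = G₁} {G₂} (≤-pred r<1+s)

-- Walks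

module Walks {r : ℕ} (G : Graph r) where

  _~_ : Fin r → Fin r → Set
  u ~ w = adj G u w ≡ true

  ~-sym : ∀ {u w} → u ~ w → w ~ u
  ~-sym {u} {w} u~w = trans (Graph.sym G w u) u~w

  ~-irrefl : ∀ {u} → ¬ (u ~ u)
  ~-irrefl {u} u~u = case trans (sym u~u) (Graph.irrefl G u) of λ ()

  -- Walk x xs y: a walk that starts at x, then visits xs in order and ends at y.
  data Walk : Fin r → List (Fin r) → Fin r → Set where
    []ʷ  : ∀ {x} → Walk x [] x
    _∷ʷ_ : ∀ {x y ys z} → x ~ y → Walk y ys z → Walk x (y ∷ ys) z

  _∷ʳʷ_ : ∀ {x xs y z} → Walk x xs y → y ~ z → Walk x (xs ∷ʳ z) z
  []ʷ      ∷ʳʷ y~z = y~z ∷ʷ []ʷ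
  (e ∷ʷ w) ∷ʳʷ y~z = e ∷ʷ (w ∷ʳʷ y~z)

  _++ʷ_ : ∀ {x xs y ys z} → Walk x xs y → Walk y ys z → Walk x (xs ++ ys) z
  []ʷ      ++ʷ w′ = w′
  (e ∷ʷ w) ++ʷ w′ = e ∷ʷ (w ++ʷ w′)

  reverseʷ : ∀ {x xs y} → Walk x xs y → Σ[ ys ∈ List (Fin r) ] Walk y ys x × (x ∷ xs ↭ y ∷ ys)
  reverseʷ []ʷ = [] , []ʷ , ↭-refl
  reverseʷ {x} (x~y ∷ʷ w) with reverseʷ w
  ... | ys , w′ , xs↭ys =
    ys ∷ʳ x , w′ ∷ʳʷ ~-sym x~y , ↭-trans (↭-prep x xs↭ys) (∷↭∷ʳ x (_ ∷ ys))

  splitʷ : ∀ {x u y} xs ys → Walk x (xs ++ u ∷ ys) y → Σ[ p ∈ Fin r ] Walk x xs p × p ~ u × Walk u ys y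
  splitʷ []       ys (e ∷ʷ w) = _ , []ʷ , e , w
  splitʷ (_ ∷ xs) ys (e ∷ʷ w) with splitʷ xs ys w
  ... | p , w₁ , p~u , w₂ = p , e ∷ʷ w₁ , p~u , w₂

  lookup-~ : ∀ {x xs y} → Walk x xs y → ∀ (i j : Fin (length (x ∷ xs))) → suc (toℕ i) ≡ toℕ j →
    lookup (x ∷ xs) i ~ lookup (x ∷ xs) j
  lookup-~ (e ∷ʷ w) zero    (suc zero) _  = e
  lookup-~ (e ∷ʷ w) (suc i) (suc j)    eq = lookup-~ w i j (ℕ.suc-injective eq)

  steps : Fin r → List (Fin r) → List (Fin r × Fin r)
  steps x []       = []
  steps x (y ∷ ys) = (x , y) ∷ steps y ys

  map-proj₂-steps : ∀ x xs → map proj₂ (steps x xs) ≡ xs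
  map-proj₂-steps x []       = refl
  map-proj₂-steps x (y ∷ ys) = cong (y ∷_) (map-proj₂-steps y ys)

  length-steps : ∀ x xs → length (steps x xs) ≡ length xs
  length-steps x []       = refl
  length-steps x (y ∷ ys) = cong suc (length-steps y ys)

  ∈-map-proj₁-steps : ∀ {x xs y} → Walk x xs y → ∀ {u} → u ∈ x ∷ xs → u ≢ y →
    u ∈ map proj₁ (steps x xs)
  ∈-map-proj₁-steps []ʷ       (here refl) u≢y = ⊥-elim (u≢y refl)
  ∈-map-proj₁-steps (_ ∷ʷ _) (here refl) u≢y = here refl
  ∈-map-proj₁-steps (_ ∷ʷ w) (there u∈) u≢y = there (∈-map-proj₁-steps w u∈ u≢y)

  split-at-step : ∀ {x xs y} (R : Fin r × Fin r → Set) → Walk x xs y → Any R (steps x xs) →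
    Σ[ A ∈ List (Fin r) ] Σ[ p ∈ Fin r ] Σ[ q ∈ Fin r ] Σ[ B ∈ List (Fin r) ]
      xs ≡ A ++ q ∷ B × R (p , q) × Walk x A p × p ~ q × Walk q B y
  split-at-step R (e ∷ʷ w) (here Rpq) = [] , _ , _ , _ , refl , Rpq , []ʷ , e , w
  split-at-step R (_∷ʷ_ {y = y} e w) (there R∈) with split-at-step R w R∈
  ... | A , p , q , B , refl , Rpq , w₁ , p~q , w₂ = y ∷ A , p , q , B , refl , Rpq , e ∷ʷ w₁ , p~q , w₂

  open-cycle : ∀ {x cs q u w} → Walk x cs q → q ~ x → u ∈ x ∷ cs → w ~ u →
    Σ[ ys ∈ List (Fin r) ] Σ[ e ∈ Fin r ] Walk w ys e × (ys ↭ x ∷ cs)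
  open-cycle cycle q~x (here refl) w~x = _ , _ , w~x ∷ʷ cycle , ↭-refl
  open-cycle {x} cycle q~x (there u∈cs) w~u with ∈-∃++ u∈cs
  ... | A , B , refl with splitʷ A B cycle
  ...   | p , w₁ , _ , w₂ = _ , p , w~u ∷ʷ (w₂ ++ʷ (q~x ∷ʷ w₁)) , ++-comm (_ ∷ B) (x ∷ A)

  walk⇒P : ∀ {x xs y n} → Walk x xs y → Unique (x ∷ xs) → n ≤ length (x ∷ xs) → P n ⊆G G
  walk⇒P {x} {xs} {n = n} w unique n≤ = f , f-inj , f-edge
    where
    f : Fin n → Fin r
    f i = lookup (x ∷ xs) (inject≤ i n≤)
    f-inj : Injective _≡_ _≡_ f
    f-inj eq = inject≤-injective n≤ n≤ _ _ (Unique⇒lookup-injective unique eq)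
    f-~ : ∀ i j → suc (toℕ i) ≡ toℕ j → f i ~ f j
    f-~ i j eq = lookup-~ w (inject≤ i n≤) (inject≤ j n≤)
      (trans (cong suc (toℕ-inject≤ i n≤)) (trans eq (sym (toℕ-inject≤ j n≤))))
    f-edge : ∀ i j → pathAdj i j ≡ true → f i ~ f j
    f-edge i j ij with suc (toℕ i) ℕ.≟ toℕ j | suc (toℕ j) ℕ.≟ toℕ i
    ... | yes i→j | _       = f-~ i j i→j
    ... | no _    | yes j→i = ~-sym (f-~ j i j→i)
    ... | no _    | no _    = case ij of λ ()

-- Upper bound

K1⊆G : ∀ {r m} (H : Graph r) v → m ≤ count (adj H v) → K1 m ⊆G H
K1⊆G {r} {m} H v m≤deg with ≤count⇒InjectsInto (adj H v) m m≤deg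
... | g , g-inj , v~g = h , h-inj , h-edge
  where
  open Walks H using (~-sym; ~-irrefl)
  h : Fin (suc m) → Fin r
  h zero    = v
  h (suc i) = g i
  v≢g : ∀ i → v ≢ g i
  v≢g i refl = ~-irrefl (v~g i)
  h-inj : Injective _≡_ _≡_ h
  h-inj {zero}  {zero}  _  = refl
  h-inj {zero}  {suc j} eq = ⊥-elim (v≢g j eq)
  h-inj {suc i} {zero}  eq = ⊥-elim (v≢g i (sym eq))
  h-inj {suc i} {suc j} eq = cong suc (g-inj eq)
  h-edge : ∀ i j → adj (K1 m) i j ≡ true → adj H (h i) (h j) ≡ true
  h-edge zero    (suc j) _ = v~g j
  h-edge (suc i) zero    _ = ~-sym (v~g i)

codegree<⇒degree≥ : ∀ {r m} (G : Graph r) v → count (adj (complement G) v) < m → r ∸ m ≤ count (adj G v)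
codegree<⇒degree≥ {r} {m} G v codeg<m = ≤-trans (∸-monoˡ-≤ m r≤) (≤-reflexive (m+n∸n≡m _ m))
  where
  open ≤-Reasoning
  r≤ : r ≤ count (adj G v) + m
  r≤ = begin
    r
      ≡⟨ count-complement (adj G v) ⟨
    count (adj G v) + count (not ∘ adj G v)
      ≤⟨ +-monoʳ-≤ _ (count-remove (not ∘ adj G v) v) ⟩
    count (adj G v) + (count (adj (complement G) v) + 𝟙 (not (adj G v v)))
      ≤⟨ +-monoʳ-≤ (count (adj G v)) (+-monoʳ-≤ (count (adj (complement G) v)) (𝟙≤1 _)) ⟩
    count (adj G v) + (count (adj (complement G) v) + 1)
      ≡⟨ cong (count (adj G v) +_) (+-comm _ 1) ⟩
    count (adj G v) + suc (count (adj (complement G) v))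
      ≤⟨ +-monoʳ-≤ _ codeg<m ⟩
    count (adj G v) + m ∎

module MinDegree {r : ℕ} (G : Graph r) (δ : ℕ) (min-degree : ∀ v → δ ≤ count (adj G v)) where

  open Walks G
  open import Data.List.Membership.DecPropositional (_≟_ {r}) using (_∈?_)

  Closed : List (Fin r) → Set
  Closed L = ∀ {u w} → u ∈ L → u ~ w → w ∈ L

  record PathThrough (v : Fin r) : Set where
    constructor path
    field
      {start end} : Fin r
      rest        : List (Fin r)
      walk        : Walk start rest end
      unique      : Unique (start ∷ rest)
      ∋v          : v ∈ start ∷ rest

    vertices : List (Fin r)
    vertices = start ∷ rest

  open PathThrough

  Extension : ∀ {v} → PathThrough v → Set
  Extension {v} p = Σ[ p′ ∈ PathThrough v ] length (rest p′) ≡ suc (length (rest p))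

  extension : ∀ {v} (p : PathThrough v) {w x xs y} → w ∉ vertices p →
    Walk x xs y → x ∷ xs ↭ w ∷ vertices p → Extension p
  extension p w∉ walk′ ↭wp =
    path _ walk′ (Unique-resp-↭ (↭-sym ↭wp) (¬Any⇒All¬ _ w∉ AllPairs.∷ unique p))
                 (∈-resp-↭ (↭-sym ↭wp) (there (∋v p))) ,
    ℕ.suc-injective (↭-length ↭wp)

  Exit : List (Fin r) → Fin r → Set
  Exit L z = ∃[ u ] z ~ u × u ∉ L

  exit? : ∀ L z → Dec (Exit L z)
  exit? L z = any? (λ u → adj G z u ≟ᵇ true ×-dec ¬? (u ∈? L))

  neighbours-inside : ∀ {z} L → ¬ Exit L z → ∀ {u} → z ~ u → u ∈ L
  neighbours-inside L no-exit {u} z~u with u ∈? L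
  ... | yes u∈L = u∈L
  ... | no  u∉L = ⊥-elim (no-exit (u , z~u , u∉L))

  crossing : Fin r → Fin r → Fin r × Fin r → Bool
  crossing x y e = adj G x (proj₂ e) ∧ adj G y (proj₁ e)

  HasCrossing : Fin r → List (Fin r) → Fin r → Set
  HasCrossing x xs y = Any (λ e → crossing x y e ≡ true) (steps x xs)

  -- Pósa's counting: x has ≥ δ neighbours among the second and y ≥ δ among the first vertices
  -- of the fewer than 2δ steps, so some step p q has both x ~ q and y ~ p.
  crossing-step : ∀ {x xs y} → Walk x xs y → ¬ Exit (x ∷ xs) x → ¬ Exit (x ∷ xs) y →
    length xs < δ + δ → HasCrossing x xs y
  crossing-step {x} {xs} {y} w x-inside y-inside short
    with Any.any? (λ e → crossing x y e ≟ᵇ true) (steps x xs)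
  ... | yes c    = c
  ... | no  none = ⊥-elim (<⇒≱ short (begin
    δ + δ
      ≤⟨ +-mono-≤ (min-degree x) (min-degree y) ⟩
    count (adj G x) + count (adj G y)
      ≤⟨ +-mono-≤ (count≤countᴸ (adj G x) proj₂ es x-covered) (count≤countᴸ (adj G y) proj₁ es y-covered) ⟩
    countᴸ (adj G x ∘ proj₂) es + countᴸ (adj G y ∘ proj₁) es
      ≤⟨ countᴸ-disjoint _ _ es (All.map ¬-not (¬Any⇒All¬ es none)) ⟩
    length es
      ≡⟨ length-steps x xs ⟩
    length xs ∎))
    where
    open ≤-Reasoning
    es : List (Fin r × Fin r)
    es = steps x xs
    x-covered : ∀ u → x ~ u → u ∈ map proj₂ es
    x-covered u x~u with neighbours-inside _ x-inside x~u
    ... | here refl = ⊥-elim (~-irrefl x~u)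
    ... | there u∈  = subst (u ∈_) (sym (map-proj₂-steps x xs)) u∈
    y-covered : ∀ u → y ~ u → u ∈ map proj₁ es
    y-covered u y~u = ∈-map-proj₁-steps w (neighbours-inside _ y-inside y~u) λ { refl → ~-irrefl y~u }

  -- x ⋯ p y ⋯ q x, with the segment from q to y reversed, is a cycle.
  crossing⇒cycle : ∀ {x xs y} → Walk x xs y → HasCrossing x xs y →
    Σ[ cs ∈ List (Fin r) ] Σ[ c ∈ Fin r ] Walk x cs c × c ~ x × (cs ↭ xs)
  crossing⇒cycle {y = y} w cross with split-at-step _ w cross
  ... | A , p , q , B , refl , x~q∧y~p , w₁ , _ , w₂ with reverseʷ w₂
  ... | B′ , w₂ʳ , qB↭yB′ =
    A ++ y ∷ B′ , q , w₁ ++ʷ (~-sym (∧-conicalʳ _ _ x~q∧y~p) ∷ʷ w₂ʳ) , ~-sym (∧-conicalˡ _ _ x~q∧y~p) ,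
    ++⁺ˡ A (↭-sym qB↭yB′)

  reroute : ∀ {v} (p : PathThrough v) → HasCrossing (start p) (rest p) (end p) →
    ∀ {u w} → u ∈ vertices p → u ~ w → w ∉ vertices p → Extension p
  reroute p cross u∈ u~w w∉ with crossing⇒cycle (walk p) cross
  ... | cs , _ , cycle , c~x , cs↭ with open-cycle cycle c~x (∈-resp-↭ (↭-prep _ (↭-sym cs↭)) u∈) (~-sym u~w)
  ... | _ , _ , walk′ , ys↭ = extension p w∉ walk′ (↭-prep _ (↭-trans ys↭ (↭-prep _ cs↭)))

  extend : ∀ {v} (p : PathThrough v) → length (rest p) < δ + δ → Extension p ⊎ Closed (vertices p)
  extend p short with exit? (vertices p) (start p)
  ... | yes (u , x~u , u∉) = inj₁ (extension p u∉ (~-sym x~u ∷ʷ walk p) ↭-refl)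
  ... | no x-inside with exit? (vertices p) (end p)
  ... | yes (u , y~u , u∉) = inj₁ (extension p u∉ (walk p ∷ʳʷ y~u) (↭-sym (∷↭∷ʳ u (vertices p))))
  ... | no y-inside with any? (λ u → u ∈? vertices p ×-dec exit? (vertices p) u)
  ... | yes (u , u∈ , w , u~w , w∉) = inj₁ (reroute p (crossing-step (walk p) x-inside y-inside short) u∈ u~w w∉)
  ... | no no-exit = inj₂ λ {u} u∈ → neighbours-inside _ λ exit → no-exit (u , u∈ , exit)

  P-or-small-closed : ∀ n → n ≤ suc (δ + δ) → ∀ v →
    P n ⊆G G ⊎ Σ[ L ∈ List (Fin r) ] v ∈ L × length L < n × Closed L
  P-or-small-closed n n≤2δ+1 v = grow n (path [] []ʷ (All.[] AllPairs.∷ AllPairs.[]) (here refl)) (m≤n+m n 1)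
    where
    grow : ∀ k (p : PathThrough v) → n ≤ length (vertices p) + k →
      P n ⊆G G ⊎ Σ[ L ∈ List (Fin r) ] v ∈ L × length L < n × Closed L
    grow zero p n≤ = inj₁ (walk⇒P (walk p) (unique p) (≤-trans n≤ (≤-reflexive (+-identityʳ _))))
    grow (suc k) p n≤ with n ≤? length (vertices p)
    ... | yes long = inj₁ (walk⇒P (walk p) (unique p) long)
    ... | no short with extend p (≤-pred (≤-trans (≰⇒> short) n≤2δ+1))
    ...   | inj₂ closed   = inj₂ (vertices p , ∋v p , ≰⇒> short , closed)
    ...   | inj₁ (p′ , eq) =
      grow k p′ (subst (n ≤_) (trans (+-suc _ k) (cong (λ l → suc l + k) (sym eq))) n≤)

  ClosedSet : (Fin r → Bool) → Set
  ClosedSet S = ∀ {u w} → S u ≡ true → u ~ w → S w ≡ true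

  _∈ᵇ_ : Fin r → List (Fin r) → Bool
  u ∈ᵇ L = ⌊ u ∈? L ⌋

  ∈ᵇ⇒∈ : ∀ {u L} → u ∈ᵇ L ≡ true → u ∈ L
  ∈ᵇ⇒∈ {u} {L} u∈ᵇL with u ∈? L
  ... | yes u∈L = u∈L
  ... | no  _   = case u∈ᵇL of λ ()

  ∈⇒∈ᵇ : ∀ {u L} → u ∈ L → u ∈ᵇ L ≡ true
  ∈⇒∈ᵇ {u} {L} u∈L with u ∈? L
  ... | yes _   = refl
  ... | no  u∉L = ⊥-elim (u∉L u∈L)

  count-∈ᵇ≤length : ∀ L → count (_∈ᵇ L) ≤ length L
  count-∈ᵇ≤length L = begin
    count (_∈ᵇ L)
      ≤⟨ count≤countᴸ (_∈ᵇ L) id L (λ u u∈ᵇL → subst (u ∈_) (sym (map-id L)) (∈ᵇ⇒∈ u∈ᵇL)) ⟩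
    countᴸ (_∈ᵇ L) L
      ≤⟨ countᴸ≤length (_∈ᵇ L) L ⟩
    length L ∎
    where open ≤-Reasoning

  inside outside : List (Fin r) → (Fin r → Bool) → Fin r → Bool
  inside  L S u = S u ∧ u ∈ᵇ L
  outside L S u = S u ∧ not (u ∈ᵇ L)

  count-inside≤length : ∀ L S → count (inside L S) ≤ length L
  count-inside≤length L S =
    ≤-trans (count-mono (inside L S) (_∈ᵇ L) (λ u → ∧-conicalʳ _ _)) (count-∈ᵇ≤length L)

  δ<count-inside : ∀ {L S v} → Closed L → ClosedSet S → v ∈ L → S v ≡ true → δ < count (inside L S)
  δ<count-inside {L} {S} {v} L-closed S-closed v∈L Sv =
    ≤-trans (s≤s (min-degree v)) (count-< (adj G v) (inside L S) neighbour-inside v (Graph.irrefl G v) v-inside)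
    where
    neighbour-inside : ∀ u → v ~ u → inside L S u ≡ true
    neighbour-inside u v~u rewrite S-closed Sv v~u | ∈⇒∈ᵇ (L-closed v∈L v~u) = refl
    v-inside : inside L S v ≡ true
    v-inside rewrite Sv | ∈⇒∈ᵇ v∈L = refl

  outside-closed : ∀ {L S} → Closed L → ClosedSet S → ClosedSet (outside L S)
  outside-closed {L} {S} L-closed S-closed {u} {w} u-outside u~w with w ∈ᵇ L in w∈ᵇL
  ... | false rewrite S-closed (∧-conicalˡ _ _ u-outside) u~w = refl
  ... | true  =
    ⊥-elim (not-¬ (∧-conicalʳ _ _ u-outside) (cong not (∈⇒∈ᵇ (L-closed (∈ᵇ⇒∈ w∈ᵇL) (~-sym u~w)))))

  count-outside< : ∀ {L S v} → Closed L → ClosedSet S → v ∈ L → S v ≡ true → count (outside L S) < count S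
  count-outside< {L} {S} L-closed S-closed v∈L Sv = begin-strict
    count (outside L S)                        <⟨ +-monoˡ-< _ (≤-trans (s≤s z≤n) (δ<count-inside L-closed S-closed v∈L Sv)) ⟩
    count (inside L S) + count (outside L S)   ≡⟨ count-split S (_∈ᵇ L) ⟨
    count S                                    ∎
    where open ≤-Reasoning

  components : ∀ n → n ≤ suc (δ + δ) → ∀ fuel (S : Fin r → Bool) → count S ≤ fuel → ClosedSet S →
    P n ⊆G G ⊎ Σ[ cs ∈ List ℕ ] sum cs ≡ count S × All (λ c → δ < c × c < n) cs
  components n n≤2δ+1 fuel S S≤fuel S-closed with any? (λ v → S v ≟ᵇ true)
  ... | no empty = inj₂ ([] , sym (count-const-false S (λ v → ¬-not (empty ∘ (v ,_)))) , All.[])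
  components n n≤2δ+1 zero S S≤0 S-closed | yes (v , Sv) =
    ⊥-elim (n≮0 (<-≤-trans (count-< (λ _ → false) S (λ _ ()) v refl Sv) S≤0))
  components n n≤2δ+1 (suc fuel) S S≤fuel S-closed | yes (v , Sv) with P-or-small-closed n n≤2δ+1 v
  ... | inj₁ P⊆G = inj₁ P⊆G
  ... | inj₂ (L , v∈L , L<n , L-closed)
    with components n n≤2δ+1 fuel (outside L S)
           (≤-pred (<-≤-trans (count-outside< L-closed S-closed v∈L Sv) S≤fuel)) (outside-closed L-closed S-closed)
  ...   | inj₁ P⊆G = inj₁ P⊆G
  ...   | inj₂ (cs , sum≡ , bounds) =
    inj₂ (count (inside L S) ∷ cs ,
          trans (cong (count (inside L S) +_) sum≡) (sym (count-split S (_∈ᵇ L))) ,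
          (δ<count-inside L-closed S-closed v∈L Sv , <-≤-trans (s≤s (count-inside≤length L S)) L<n)
            All.∷ bounds)

P⊆G-of-min-degree : ∀ {r d δ} (G : Graph r) → (∀ v → δ ≤ count (adj G v)) → d ≤ δ + δ →
  (∀ k → k * suc δ ≤ r → r ≤ k * d → ⊥) → P (suc d) ⊆G G
P⊆G-of-min-degree {r} {d} {δ} G min-degree d≤2δ no-split
  with MinDegree.components G δ min-degree (suc d) (s≤s d≤2δ) r (λ _ → true)
         (≤-reflexive (count-const-true _ λ _ → refl)) (λ _ _ → refl)
... | inj₁ P⊆G = P⊆G
... | inj₂ (cs , sum≡ , bounds) with sum-bounds cs (All.map (λ (δ<c , c<n) → δ<c , ≤-pred c<n) bounds)
...   | lower , upper = ⊥-elim (no-split (length cs) (subst (length cs * suc δ ≤_) sum≡r lower)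
                                                     (subst (_≤ length cs * d) sum≡r upper))
  where
  sum≡r : sum cs ≡ r
  sum≡r = trans sum≡ (count-const-true _ λ _ → refl)

arrows-upper : ∀ {r d m} δ → δ + m ≤ r → d ≤ δ + δ →
  (∀ k → k * suc δ ≤ r → r ≤ k * d → ⊥) → Arrows r (P (suc d)) (K1 m)
arrows-upper {r} {d} {m} δ δ+m≤r d≤2δ no-split G with any? (λ v → m ≤? count (adj (complement G) v))
... | yes (v , m≤codeg) = inj₂ (K1⊆G (complement G) v m≤codeg)
... | no  small         = inj₁ (P⊆G-of-min-degree G min-degree d≤2δ no-split)
  where
  min-degree : ∀ v → δ ≤ count (adj G v)
  min-degree v = ≤-trans (m+n≤o⇒m≤o∸n δ δ+m≤r) (codegree<⇒degree≥ G v (≰⇒> (small ∘ (v ,_))))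

-- Lower bound: disjoint cliques

-- The index of the block containing u when Fin (sum cs) is cut into consecutive blocks of sizes cs.
block : (cs : List ℕ) → Fin (sum cs) → ℕ
block (c ∷ cs) u = [ const 0 , suc ∘ block cs ]′ (splitAt c u)

block-↑ˡ : ∀ c cs (i : Fin c) → block (c ∷ cs) (i ↑ˡ sum cs) ≡ 0
block-↑ˡ c cs i = cong [ const 0 , suc ∘ block cs ]′ (splitAt-↑ˡ c i (sum cs))

block-↑ʳ : ∀ c cs (j : Fin (sum cs)) → block (c ∷ cs) (c ↑ʳ j) ≡ suc (block cs j)
block-↑ʳ c cs j = cong [ const 0 , suc ∘ block cs ]′ (splitAt-↑ʳ c (sum cs) j)

blockmates : (cs : List ℕ) → Fin (sum cs) → Fin (sum cs) → Bool
blockmates cs u w = ⌊ block cs u ℕ.≟ block cs w ⌋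

blockmates-↑ˡ-↑ʳ : ∀ c cs (i : Fin c) (j : Fin (sum cs)) →
  blockmates (c ∷ cs) (i ↑ˡ sum cs) (c ↑ʳ j) ≡ false
blockmates-↑ˡ-↑ʳ c cs i j =
  ¬-not λ same → 0≢1+n (trans (sym (block-↑ˡ c cs i)) (trans (⌊≟⌋⇒≡ same) (block-↑ʳ c cs j)))

count-blockmates-↑ˡ : ∀ c cs (i : Fin c) → count (blockmates (c ∷ cs) (i ↑ˡ sum cs)) ≡ c
count-blockmates-↑ˡ c cs i = begin
  count S
    ≡⟨ count-↑ c S ⟩
  count (S ∘ (_↑ˡ sum cs)) + count (S ∘ (c ↑ʳ_))
    ≡⟨ cong₂ _+_ (count-const-true _ same-block) (count-const-false _ (blockmates-↑ˡ-↑ʳ c cs i)) ⟩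
  c + 0
    ≡⟨ +-identityʳ c ⟩
  c ∎
  where
  open ≡-Reasoning
  S : Fin (c + sum cs) → Bool
  S = blockmates (c ∷ cs) (i ↑ˡ sum cs)
  same-block : ∀ i′ → S (i′ ↑ˡ sum cs) ≡ true
  same-block i′ = ≡⇒⌊≟⌋ (trans (block-↑ˡ c cs i) (sym (block-↑ˡ c cs i′)))

count-blockmates-↑ʳ : ∀ c cs (j : Fin (sum cs)) →
  count (blockmates (c ∷ cs) (c ↑ʳ j)) ≡ count (blockmates cs j)
count-blockmates-↑ʳ c cs j = begin
  count S
    ≡⟨ count-↑ c S ⟩
  count (S ∘ (_↑ˡ sum cs)) + count (S ∘ (c ↑ʳ_))
    ≡⟨ cong₂ _+_ (count-const-false _ other-block) (count-cong same-shifted) ⟩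
  0 + count (blockmates cs j) ∎
  where
  open ≡-Reasoning
  S : Fin (c + sum cs) → Bool
  S = blockmates (c ∷ cs) (c ↑ʳ j)
  other-block : ∀ i → S (i ↑ˡ sum cs) ≡ false
  other-block i = trans (⌊≟⌋-sym (block (c ∷ cs) (c ↑ʳ j)) _) (blockmates-↑ˡ-↑ʳ c cs i j)
  same-shifted : ∀ j′ → S (c ↑ʳ j′) ≡ blockmates cs j j′
  same-shifted j′ =
    trans (cong₂ (λ b b′ → ⌊ b ℕ.≟ b′ ⌋) (block-↑ʳ c cs j) (block-↑ʳ c cs j′)) (⌊≟⌋-suc _ _)

count-blockmates : ∀ cs (v : Fin (sum cs)) → count (blockmates cs v) ∈ cs
count-blockmates (c ∷ cs) v =
  subst (λ u → count (blockmates (c ∷ cs) u) ∈ c ∷ cs) (join-splitAt c (sum cs) v) (by-part (splitAt c v))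
  where
  by-part : ∀ x → count (blockmates (c ∷ cs) (join c (sum cs) x)) ∈ c ∷ cs
  by-part (inj₁ i) = here (count-blockmates-↑ˡ c cs i)
  by-part (inj₂ j) = there (subst (_∈ cs) (sym (count-blockmates-↑ʳ c cs j)) (count-blockmates cs j))

blocks : (cs : List ℕ) → Graph (sum cs)
blocks cs = record
  { adj    = λ u w → blockmates cs u w ∧ neq u w
  ; sym    = λ u w → cong₂ _∧_ (⌊≟⌋-sym (block cs u) (block cs w)) (neq-sym u w)
  ; irrefl = λ u → trans (cong (blockmates cs u u ∧_) (neq-irrefl u)) (∧-zeroʳ _)
  }

pathAdj-inject₁-suc : ∀ {n} (i : Fin n) → pathAdj (inject₁ i) (suc i) ≡ true
pathAdj-inject₁-suc i =
  cong (_∨ ⌊ suc (toℕ (suc i)) ℕ.≟ toℕ (inject₁ i) ⌋) (≡⇒⌊≟⌋ (cong suc (toℕ-inject₁ i)))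

constant-along-path : ∀ {A : Set} {n} (g : Fin (suc n) → A) → (∀ (i : Fin n) → g (inject₁ i) ≡ g (suc i)) →
  ∀ i → g i ≡ g zero
constant-along-path             g step zero    = refl
constant-along-path {n = suc n} g step (suc i) =
  trans (sym (step i)) (constant-along-path (g ∘ inject₁) (step ∘ inject₁) i)

blocks-P-free : ∀ {n} cs → All (_≤ n) cs → ¬ (P (suc n) ⊆G blocks cs)
blocks-P-free {n} cs small (f , f-inj , f-edge) =
  <⇒≱ (s≤s (All.lookup small (count-blockmates cs (f zero))))
      (InjectsInto⇒≤count (blockmates cs (f zero)) (suc n) (f , f-inj , same-block))
  where
  same-block : ∀ i → blockmates cs (f zero) (f i) ≡ true
  same-block i = ≡⇒⌊≟⌋ (sym (constant-along-path (block cs ∘ f)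
    (λ i → ⌊≟⌋⇒≡ (∧-conicalˡ _ _ (f-edge (inject₁ i) (suc i) (pathAdj-inject₁-suc i)))) i))

blocks-K1-free : ∀ {m} cs → All (λ c → sum cs ≤ c + m) cs → ¬ (K1 (suc m) ⊆G complement (blocks cs))
blocks-K1-free {m} cs large (h , h-inj , h-edge) =
  <⇒≱ (s≤s outside≤m)
      (InjectsInto⇒≤count (not ∘ blockmates cs (h zero)) (suc m) (h ∘ suc , suc-injective ∘ h-inj , other-block))
  where
  other-block : ∀ i → not (blockmates cs (h zero) (h (suc i))) ≡ true
  other-block i = trans (cong not (sym (∧-identityʳ b)))
    (subst (λ e → not (b ∧ e) ≡ true) (∧-conicalʳ _ _ edge) (∧-conicalˡ _ _ edge))
    where
    b : Bool
    b = blockmates cs (h zero) (h (suc i))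
    edge : not (b ∧ neq (h zero) (h (suc i))) ∧ neq (h zero) (h (suc i)) ≡ true
    edge = h-edge zero (suc i) refl
  outside≤m : count (not ∘ blockmates cs (h zero)) ≤ m
  outside≤m = +-cancelˡ-≤ (count (blockmates cs (h zero))) _ _ (begin
    count (blockmates cs (h zero)) + count (not ∘ blockmates cs (h zero))
      ≡⟨ count-complement _ ⟩
    sum cs
      ≤⟨ All.lookup large (count-blockmates cs (h zero)) ⟩
    count (blockmates cs (h zero)) + m ∎)
    where open ≤-Reasoning

blocks-not-arrows : ∀ {n m} cs → All (λ c → c ≤ n × sum cs ≤ c + m) cs →
  ¬ Arrows (sum cs) (P (suc n)) (K1 (suc m))
blocks-not-arrows cs bounds arrows with arrows (blocks cs)
... | inj₁ P⊆ = blocks-P-free cs (All.map proj₁ bounds) P⊆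
... | inj₂ K⊆ = blocks-K1-free cs (All.map proj₂ bounds) K⊆

-- Arithmetic of t(n,m)

-- Throughout d = n − 1, a = m − 1 and β = ⌈a/d⌉, so that α ≤ γ reads a(β + 1) ≤ β²d.

dβ≤[1+β]δ : ∀ {d β a δ} → δ + a ≡ d * β → a * (β + 1) ≤ β * β * d → d * β ≤ suc β * δ
dβ≤[1+β]δ {d} {β} {a} {δ} δ+a≡dβ a[β+1]≤ββd = +-cancelʳ-≤ (β * β * d) _ _ (begin
  d * β + β * β * d          ≡⟨ solve (d ∷ β ∷ []) ⟩
  suc β * (d * β)            ≡⟨ cong (suc β *_) δ+a≡dβ ⟨
  suc β * (δ + a)            ≡⟨ solve (β ∷ δ ∷ a ∷ []) ⟩
  suc β * δ + a * (β + 1)    ≤⟨ +-monoʳ-≤ (suc β * δ) a[β+1]≤ββd ⟩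
  suc β * δ + β * β * d      ∎)
  where open ≤-Reasoning

d≤δ+δ-α≤γ : ∀ {d β a δ} → 1 ≤ β → δ + a ≡ d * β → a * (β + 1) ≤ β * β * d → d ≤ δ + δ
d≤δ+δ-α≤γ {d} {β} {a} {δ} 1≤β δ+a≡dβ a[β+1]≤ββd = *-cancelˡ-≤ (suc β) (begin
  suc β * d                  ≤⟨ *-monoˡ-≤ d (+-monoˡ-≤ β 1≤β) ⟩
  (β + β) * d                ≡⟨ solve (β ∷ d ∷ []) ⟩
  d * β + d * β              ≤⟨ +-mono-≤ dβ≤ dβ≤ ⟩
  suc β * δ + suc β * δ      ≡⟨ solve (β ∷ δ ∷ []) ⟩
  suc β * (δ + δ)            ∎)
  where
  open ≤-Reasoning
  dβ≤ : d * β ≤ suc β * δ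
  dβ≤ = dβ≤[1+β]δ {d} {β} {a} {δ} δ+a≡dβ a[β+1]≤ββd

no-split-α≤γ : ∀ {d β a δ} k → 1 ≤ β → δ + a ≡ d * β → a * (β + 1) ≤ β * β * d →
  k * suc δ ≤ suc (d * β) → suc (d * β) ≤ k * d → ⊥
no-split-α≤γ {d} {β} {a} {δ} k 1≤β δ+a≡dβ a[β+1]≤ββd lower upper with k ≤? β
... | yes k≤β = 1+n≰n (≤-trans upper (≤-trans (*-monoˡ-≤ d k≤β) (≤-reflexive (*-comm β d))))
... | no  k≰β = <⇒≱ (begin-strict
  suc (d * β)                <⟨ ≤-reflexive (+-comm 2 (d * β)) ⟩
  d * β + 2                  ≤⟨ +-mono-≤ (dβ≤[1+β]δ {d} {β} {a} {δ} δ+a≡dβ a[β+1]≤ββd) (s≤s 1≤β) ⟩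
  suc β * δ + suc β          ≡⟨ solve (β ∷ δ ∷ []) ⟩
  suc β * suc δ              ∎) (≤-trans (*-monoˡ-≤ (suc δ) (≰⇒> k≰β)) lower)
  where open ≤-Reasoning

d≤q+q-α>γ : ∀ {d β a q} → 1 ≤ β → a < β * suc q → β * β * d < a * (β + 1) → d ≤ q + q
d≤q+q-α>γ {d} {β} {a} {q} 1≤β a<β[1+q] ββd<a[β+1] with d ≤? q + q
... | yes d≤q+q = d≤q+q
... | no  d≰q+q = ⊥-elim (<⇒≱ ββd<a[β+1] (≤-trans (<⇒≤ a[β+1]<) (*-monoʳ-≤ (β * β) (≰⇒> d≰q+q))))
  where
  open ≤-Reasoning
  β≤ββ : β ≤ β * β
  β≤ββ = subst (_≤ β * β) (*-identityʳ β) (*-monoʳ-≤ β 1≤β)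
  a[β+1]+β+1≤ : a * (β + 1) + 1 + β ≤ β * β * q + β * q + β * β + β
  a[β+1]+β+1≤ = begin
    a * (β + 1) + 1 + β              ≡⟨ solve (a ∷ β ∷ []) ⟩
    suc a * suc β                    ≤⟨ *-monoˡ-≤ (suc β) a<β[1+q] ⟩
    β * suc q * suc β                ≡⟨ solve (β ∷ q ∷ []) ⟩
    β * β * q + β * q + β * β + β    ∎
  a[β+1]< : a * (β + 1) < β * β * suc (q + q)
  a[β+1]< = begin-strict
    a * (β + 1)                      <⟨ ≤-reflexive (+-comm 1 _) ⟩
    a * (β + 1) + 1                  ≤⟨ +-cancelʳ-≤ β _ _ a[β+1]+β+1≤ ⟩
    β * β * q + β * q + β * β        ≤⟨ +-monoˡ-≤ (β * β) (+-monoʳ-≤ (β * β * q) (*-monoˡ-≤ q β≤ββ)) ⟩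
    β * β * q + β * β * q + β * β    ≡⟨ solve (β ∷ q ∷ []) ⟩
    β * β * suc (q + q)              ∎

no-split-α>γ : ∀ {d β a q} k → a < β * suc q → β * β * d < a * (β + 1) →
  k * suc q ≤ q + suc a → q + suc a ≤ k * d → ⊥
no-split-α>γ {d} {β} {a} {q} k a<β[1+q] ββd<a[β+1] lower upper with k ≤? β
... | yes k≤β = <⇒≱ ββd<a[β+1] (begin
  a * (β + 1)          ≤⟨ <⇒≤ a[β+1]<β[q+1+a] ⟩
  β * (q + suc a)      ≤⟨ *-monoʳ-≤ β (≤-trans upper (*-monoˡ-≤ d k≤β)) ⟩
  β * (β * d)          ≡⟨ *-assoc β β d ⟨
  β * β * d            ∎)
  where
  open ≤-Reasoning
  a[β+1]<β[q+1+a] : a * (β + 1) < β * (q + suc a)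
  a[β+1]<β[q+1+a] = begin-strict
    a * (β + 1)        <⟨ ≤-reflexive (solve (a ∷ β ∷ [])) ⟩
    a * β + suc a      ≤⟨ +-monoʳ-≤ (a * β) a<β[1+q] ⟩
    a * β + β * suc q  ≡⟨ solve (a ∷ β ∷ q ∷ []) ⟩
    β * (q + suc a)    ∎
... | no  k≰β = <⇒≱ (begin-strict
  q + suc a            <⟨ ≤-reflexive (solve (q ∷ a ∷ [])) ⟩
  suc a + suc q        ≤⟨ +-monoˡ-≤ (suc q) a<β[1+q] ⟩
  β * suc q + suc q    ≡⟨ solve (β ∷ q ∷ []) ⟩
  suc β * suc q        ∎) (≤-trans (*-monoˡ-≤ (suc q) (≰⇒> k≰β)) lower)
  where open ≤-Reasoning

ceilDiv-bounds : ∀ a d → a ≤ ceilDiv a (suc d) * suc d × ceilDiv a (suc d) * suc d ≤ suc d + a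
ceilDiv-bounds a d = a≤βd , βd≤d+a
  where
  open ≤-Reasoning
  β : ℕ
  β = ceilDiv a (suc d)
  a≤βd : a ≤ β * suc d
  a≤βd = +-cancelʳ-≤ d a (β * suc d) (begin
    a + d                           ≡⟨ m≡m%n+[m/n]*n (a + d) (suc d) ⟩
    (a + d) % suc d + β * suc d     ≤⟨ +-monoˡ-≤ (β * suc d) (≤-pred (m%n<n (a + d) (suc d))) ⟩
    d + β * suc d                   ≡⟨ +-comm d _ ⟩
    β * suc d + d                   ∎)
  βd≤d+a : β * suc d ≤ suc d + a
  βd≤d+a = begin
    β * suc d                       ≤⟨ m/n*n≤m (a + d) (suc d) ⟩
    a + d                           ≤⟨ +-monoʳ-≤ a (n≤1+n d) ⟩
    a + suc d                       ≡⟨ +-comm a (suc d) ⟩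
    suc d + a                       ∎

ceilDiv-positive : ∀ a d → 1 ≤ a → 1 ≤ ceilDiv a (suc d)
ceilDiv-positive a d 1≤a = m≥n⇒m/n>0 (+-monoˡ-≤ d 1≤a)

ramsey-α≤γ : ∀ {d a β} → 1 ≤ β → a ≤ β * d → β * d ≤ d + a → a * (β + 1) ≤ β * β * d →
  IsRamsey (P (suc d)) (K1 (suc a)) (d * β + 1)
ramsey-α≤γ {d} {a} {β} 1≤β a≤βd βd≤d+a α≤γ =
  subst (IsRamsey (P (suc d)) (K1 (suc a))) (+-comm 1 (d * β))
    (IsRamsey-suc {G₁ = P (suc d)} {K1 (suc a)} upper lower)
  where
  δ : ℕ
  δ = d * β ∸ a
  δ+a≡dβ : δ + a ≡ d * β
  δ+a≡dβ = m∸n+n≡m (subst (a ≤_) (*-comm β d) a≤βd)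
  upper : Arrows (suc (d * β)) (P (suc d)) (K1 (suc a))
  upper = arrows-upper δ (≤-reflexive (trans (+-suc δ a) (cong suc δ+a≡dβ)))
            (d≤δ+δ-α≤γ {d} {β} {a} {δ} 1≤β δ+a≡dβ α≤γ)
            (λ k → no-split-α≤γ {d} {β} {a} {δ} k 1≤β δ+a≡dβ α≤γ)
  sum≡ : sum (replicate β d) ≡ d * β
  sum≡ = trans (sum-replicate β d) (*-comm β d)
  lower : ¬ Arrows (d * β) (P (suc d)) (K1 (suc a))
  lower = subst (λ s → ¬ Arrows s (P (suc d)) (K1 (suc a))) sum≡
            (blocks-not-arrows (replicate β d)
              (replicate⁺ β (≤-refl , subst (_≤ d + a) (sym (sum-replicate β d)) βd≤d+a)))

ramsey-α>γ : ∀ {d a β q ρ} → a ≡ ρ + q * β → ρ < β → a ≤ β * d → β * β * d < a * (β + 1) →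
  IsRamsey (P (suc d)) (K1 (suc a)) (q + suc a)
ramsey-α>γ {d} {a} {β} {q} {ρ} a≡ρ+qβ ρ<β a≤βd α>γ =
  subst (IsRamsey (P (suc d)) (K1 (suc a))) (sym (+-suc q a))
    (IsRamsey-suc {G₁ = P (suc d)} {K1 (suc a)} upper lower)
  where
  open ≤-Reasoning
  a<β[1+q] : a < β * suc q
  a<β[1+q] = begin-strict
    a              ≡⟨ a≡ρ+qβ ⟩
    ρ + q * β      <⟨ +-monoˡ-< (q * β) ρ<β ⟩
    β + q * β      ≡⟨ solve (β ∷ q ∷ []) ⟩
    β * suc q      ∎
  qβ≤dβ : q * β ≤ d * β
  qβ≤dβ = begin
    q * β          ≤⟨ m≤n+m (q * β) ρ ⟩
    ρ + q * β      ≡⟨ a≡ρ+qβ ⟨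
    a              ≤⟨ a≤βd ⟩
    β * d          ≡⟨ *-comm β d ⟩
    d * β          ∎
  q≤d : q ≤ d
  q≤d = *-cancelʳ-≤ q d β {{>-nonZero (<-≤-trans (s≤s z≤n) ρ<β)}} qβ≤dβ
  q<d : 0 < ρ → q < d
  q<d 0<ρ = *-cancelʳ-< β q d (begin-strict
    q * β          <⟨ +-monoˡ-≤ (q * β) 0<ρ ⟩
    ρ + q * β      ≡⟨ a≡ρ+qβ ⟨
    a              ≤⟨ a≤βd ⟩
    β * d          ≡⟨ *-comm β d ⟩
    d * β          ∎)
  upper : Arrows (suc (q + a)) (P (suc d)) (K1 (suc a))
  upper = subst (λ r → Arrows r (P (suc d)) (K1 (suc a))) (+-suc q a)
    (arrows-upper q ≤-refl (d≤q+q-α>γ (<-≤-trans (s≤s z≤n) ρ<β) a<β[1+q] α>γ)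
                          (λ k → no-split-α>γ k a<β[1+q] α>γ))
  e : ℕ
  e = suc β ∸ ρ
  cs : List ℕ
  cs = replicate ρ (suc q) ++ replicate e q
  sum≡ : sum cs ≡ q + a
  sum≡ = begin-equality
    sum cs
      ≡⟨ sum-++ (replicate ρ (suc q)) (replicate e q) ⟩
    sum (replicate ρ (suc q)) + sum (replicate e q)
      ≡⟨ cong₂ _+_ (sum-replicate ρ (suc q)) (sum-replicate e q) ⟩
    ρ * suc q + e * q
      ≡⟨ regroup e ⟩
    (e + ρ) * q + ρ
      ≡⟨ cong (λ z → z * q + ρ) (m∸n+n≡m (m≤n⇒m≤1+n (<⇒≤ ρ<β))) ⟩
    suc β * q + ρ
      ≡⟨ solve (β ∷ q ∷ ρ ∷ []) ⟩
    q + (ρ + q * β)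
      ≡⟨ cong (q +_) a≡ρ+qβ ⟨
    q + a ∎
    where
    regroup : ∀ e → ρ * suc q + e * q ≡ (e + ρ) * q + ρ
    regroup e = solve (ρ ∷ q ∷ e ∷ [])
  lower : ¬ Arrows (q + a) (P (suc d)) (K1 (suc a))
  lower = subst (λ s → ¬ Arrows s (P (suc d)) (K1 (suc a))) sum≡ (blocks-not-arrows cs (++⁺
    (replicate⁺-nonempty ρ (λ 0<ρ → q<d 0<ρ , ≤-trans (≤-reflexive sum≡) (n≤1+n (q + a))))
    (replicate⁺ e (q≤d , ≤-reflexive sum≡))))

ramsey-by-case : ∀ d a β → 1 ≤ β → a ≤ β * d → β * d ≤ d + a →
  IsRamsey (P (suc d)) (K1 (suc a)) (if a * (β + 1) ≤ᵇ β * β * d then d * β + 1 else floorDiv a β + suc a)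
ramsey-by-case d a zero    ()  _ _
ramsey-by-case d a (suc β) 1≤β a≤βd βd≤d+a with a * (suc β + 1) ≤ᵇ suc β * suc β * d in cmp
... | true  = ramsey-α≤γ 1≤β a≤βd βd≤d+a (≤ᵇ⇒≤ _ _ (subst T (sym cmp) tt))
... | false =
  ramsey-α>γ (m≡m%n+[m/n]*n a (suc β)) (m%n<n a (suc β)) a≤βd (≰⇒> (subst T cmp ∘ ≤⇒≤ᵇ))

theorem2 : (n m : ℕ) → 2 ≤ n → 2 ≤ m → IsRamsey (P n) (K1 m) (t n m)
theorem2 (suc zero)    _             (s≤s ()) _
theorem2 (suc (suc d)) (suc zero)    _        (s≤s ())
theorem2 (suc (suc d)) (suc (suc a)) _        _ =
  ramsey-by-case (suc d) (suc a) (ceilDiv (suc a) (suc d)) (ceilDiv-positive (suc a) d (s≤s z≤n))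
    (proj₁ (ceilDiv-bounds (suc a) d)) (proj₂ (ceilDiv-bounds (suc a) d))
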